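{- As $q$ (a prime power) tends to infinity, almost all maps $\mathbb{F}_q\to\mathbb{F}_q$ have least additive index $q$; that is, the proportion, among all $q^q$ self-maps of $\mathbb{F}_q$, of those whose least codimension is strictly less than $n$ (where $q=p^n$) tends to $0$.
   Context: Let $q=p^n$ with $p$ prime. A linearised polynomial over $\mathbb{F}_q$ is one of the form $\sum_{j=0}^{n-1}c_jX^{p^j}$, $c_j\in\mathbb{F}_q$. A map $F:\mathbb{F}_q\to\mathbb{F}_q$ has codimension $k$ (additive index $p^k$) if there exist an $\mathbb{F}_p$-linear subspace $U\le\mathbb{F}_q$ of codimension $k$, a linearised polynomial $M$ and constants $a_V\in\mathbb{F}_q$ for each coset $V$ of $U$ with $F(\xi)=M(\xi)+a_{U+\xi}$ for all $\xi\in\mathbb{F}_q$. The least codimension of $F$ is the smallest such $k$, and $p^k$ is then its least additive index. -}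

module Defs where

open import Data.Nat as ℕ using (ℕ; zero; suc; _<_; _≤_)
open import Data.Fin using (Fin)
open import Data.Fin.Subset using (Subset; _∈_; ∣_∣)
open import Data.Product using (Σ; ∃; ∃-syntax; _×_)
open import Relation.Binary.PropositionalEquality using (_≡_; _≢_)
open import Relation.Nullary using (¬_)
open import Algebra.Structures using (IsCommutativeRing)

record FiniteField (q : ℕ) : Set where
  infixl 6 _+_
  infixl 7 _*_
  field
    _+_ _*_ : Fin q → Fin q → Fin q
    -_      : Fin q → Fin q
    0# 1#   : Fin q
    isCommutativeRing : IsCommutativeRing _≡_ _+_ _*_ -_ 0# 1#
    0≢1     : 0# ≢ 1#
    inverse : ∀ x → x ≢ 0# → ∃[ y ] (x * y ≡ 1#)

module _ {q : ℕ} (F : FiniteField q) where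
  open FiniteField F

  pow : Fin q → ℕ → Fin q
  pow x zero    = 1#
  pow x (suc m) = x * pow x m

  sumF : (m : ℕ) → (Fin m → Fin q) → Fin q
  sumF zero    f = 0#
  sumF (suc m) f = f Fin.zero + sumF m (λ j → f (Fin.suc j))
    where import Data.Fin as Fin

  linearised : (p n : ℕ) → (Fin n → Fin q) → Fin q → Fin q
  linearised p n c ξ = sumF n (λ j → c j * pow ξ (p ℕ.^ Data.Fin.toℕ j))

  -- F_p-linear subspace of F_q (char p): an additive subgroup
  -- (closure under F_p-scalars is closure under repeated addition).
  record IsFpSubspace (U : Subset q) : Set where
    field
      zero∈ : 0# ∈ U
      +-closed : ∀ {x y} → x ∈ U → y ∈ U → (x + y) ∈ U
      neg-closed : ∀ {x} → x ∈ U → (- x) ∈ U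

  -- f has codimension k (additive index p^k), where q = p^n:
  -- there is an F_p-subspace U with |U| · p^k = q, a linearised polynomial M,
  -- and constants a_V, one per coset V of U (encoded as a function a : F_q → F_q
  -- constant on cosets, a(ξ) = a_{U+ξ}), with f(ξ) = M(ξ) + a_{U+ξ}.
  HasCodim : (p n : ℕ) → (Fin q → Fin q) → ℕ → Set
  HasCodim p n f k =
    Σ (Subset q) λ U → IsFpSubspace U × (∣ U ∣ ℕ.* (p ℕ.^ k) ≡ q) ×
    Σ (Fin n → Fin q) λ c → Σ (Fin q → Fin q) λ a →
      (∀ ξ η → (ξ + (- η)) ∈ U → a ξ ≡ a η) ×
      (∀ ξ → f ξ ≡ linearised p n c ξ + a ξ)

  LeastCodim : (p n : ℕ) → (Fin q → Fin q) → ℕ → Set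
  LeastCodim p n f k = HasCodim p n f k × (∀ j → HasCodim p n f j → k ≤ j)

-- A map of codimension k < n comes with a subgroup U of order p^(n-k) > 1, so U
-- contains some u ≠ 0, and translation by u sends the least element of each coset
-- of U to a non-least one: there are at most q/2 cosets. As f = M + a with a
-- constant on cosets, f is determined by U, the n coefficients of M and its values
-- on the least coset elements. Hence at most 2^q · q^n · q^(q/2) maps have
-- codimension below n, which is at most q^q / (m + 1) once q ≥ 64 + 4m.

module Submission where

open import Defs
open import Data.Nat using (ℕ; suc; _*_; _^_; _≤_; _<_)
open import Data.Nat.Primality using (Prime; prime⇒nonTrivial)
open import Data.Fin using (Fin)
open import Data.Vec using (Vec; lookup)
open import Data.List using (List; length)
open import Data.List.Relation.Unary.All using (All)
open import Data.List.Relation.Unary.Unique.Propositional using (Unique)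
open import Data.Product using (∃-syntax; _×_)

open import Data.Nat as Nat using (zero; nonTrivial⇒n>1; ⌊_/2⌋; ⌈_/2⌉; NonZero; z≤n; s≤s)
open import Data.Nat.Properties
open import Data.Nat.Tactic.RingSolver using (solve-∀)
open import Data.Fin as Fin using (combine; inject≤; toℕ)
import Data.Fin.Properties as Finₚ
open import Data.Fin.Induction using (<-wellFounded)
open import Data.Fin.Subset using (Subset; _∈_; _⊆_; ∣_∣; ⁅_⁆)
open import Data.Fin.Subset.Properties using (_∈?_; p⊆q⇒∣p∣≤∣q∣; x∈⁅x⁆; ∣⁅x⁆∣≡1)
open import Data.Bool using (Bool; true; false)
open import Data.Vec.Relation.Binary.Pointwise.Extensional using (ext; Pointwise-≡⇒≡)
import Data.List as List
open import Data.List.Properties using (length-++; length-map)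
open import Data.List.Membership.Propositional using () renaming (_∈_ to _∈ₗ_)
open import Data.List.Membership.Propositional.Properties using (∈-filter⁺; ∈-filter⁻; ∈-allFin; ∈-map⁻; ∈-lookup)
import Data.List.Relation.Unary.All as All
open import Data.List.Relation.Unary.AllPairs using (_∷_)
open import Data.List.Relation.Unary.Any using (index)
open import Data.List.Relation.Unary.Any.Properties using (lookup-index)
import Data.List.Relation.Unary.Unique.Propositional.Properties as Uniqueₚ
open import Data.Product using (_,_; proj₂)
open import Data.Empty using (⊥-elim)
open import Function using (_∘_)
open import Induction.WellFounded using (Acc; acc)
open import Algebra.Bundles using (AbelianGroup)
open import Algebra.Structures using (module IsCommutativeRing)
import Algebra.Properties.AbelianGroup as AbelianGroupProperties
open import Relation.Binary.Definitions using (tri<; tri≈; tri>)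
open import Relation.Binary.PropositionalEquality
open import Relation.Nullary using (¬_; Dec; yes; no; ¬?)
open import Relation.Nullary.Decidable using (_×-dec_)

lookup-injective : ∀ {A : Set} {xs : List A} → Unique xs →
                   ∀ {i j} → List.lookup xs i ≡ List.lookup xs j → i ≡ j
lookup-injective (_ ∷ _) {Fin.zero} {Fin.zero} _ = refl
lookup-injective (x∉ ∷ _) {Fin.zero} {Fin.suc j} eq = ⊥-elim (All.lookup x∉ (∈-lookup j) eq)
lookup-injective (x∉ ∷ _) {Fin.suc i} {Fin.zero} eq = ⊥-elim (All.lookup x∉ (∈-lookup i) (sym eq))
lookup-injective (_ ∷ u) {Fin.suc i} {Fin.suc j} eq = cong Fin.suc (lookup-injective u eq)

Unique⇒length≤ : ∀ {n} {xs : List (Fin n)} → Unique xs → length xs ≤ n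
Unique⇒length≤ u = Finₚ.injective⇒≤ (lookup-injective u)

length≤-of-injective-code : ∀ {A : Set} {P : A → Set} {S} (code : ∀ x → P x → Fin S) →
  (∀ {x y} px py → code x px ≡ code y py → x ≡ y) →
  ∀ {xs} → Unique xs → All P xs → length xs ≤ S
length≤-of-injective-code code code-injective {xs} u pxs =
  Finₚ.injective⇒≤ {f = λ i → code (List.lookup xs i) (All.lookup pxs (∈-lookup i))}
    (lookup-injective u ∘ code-injective _ _)

1<∣U∣⇒∃∈≢ : ∀ {n} {U : Subset n} → 1 < ∣ U ∣ → ∀ z → ∃[ x ] (x ∈ U × x ≢ z)
1<∣U∣⇒∃∈≢ {U = U} 1<∣U∣ z with Finₚ.any? (λ x → (x ∈? U) ×-dec ¬? (x Fin.≟ z))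
... | yes found = found
... | no ¬found = ⊥-elim (<⇒≱ 1<∣U∣ (≤-trans (p⊆q⇒∣p∣≤∣q∣ U⊆⁅z⁆) (≤-reflexive (∣⁅x⁆∣≡1 z))))
  where
  U⊆⁅z⁆ : U ⊆ ⁅ z ⁆
  U⊆⁅z⁆ {x} x∈U with x Fin.≟ z
  ... | yes refl = x∈⁅x⁆ z
  ... | no x≢z   = ⊥-elim (¬found (x , x∈U , x≢z))

encode : ∀ {B} k → (Fin k → Fin B) → Fin (B ^ k)
encode zero    c = Fin.zero
encode (suc k) c = combine (c Fin.zero) (encode k (c ∘ Fin.suc))

encode-injective : ∀ {B} k {c c′ : Fin k → Fin B} → encode k c ≡ encode k c′ → ∀ j → c j ≡ c′ j
encode-injective (suc k) {c} {c′} eq =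
  let head≡ , tail≡ = Finₚ.combine-injective (c Fin.zero) _ (c′ Fin.zero) _ eq in
  λ { Fin.zero → head≡ ; (Fin.suc j) → encode-injective k tail≡ j }

bit : Bool → Fin 2
bit false = Fin.zero
bit true  = Fin.suc Fin.zero

bit-injective : ∀ {a b} → bit a ≡ bit b → a ≡ b
bit-injective {false} {false} _ = refl
bit-injective {true}  {true}  _ = refl

encodeSubset : ∀ {q} → Subset q → Fin (2 ^ q)
encodeSubset {q} U = encode q (bit ∘ lookup U)

encodeSubset-injective : ∀ {q} {U U′ : Subset q} → encodeSubset U ≡ encodeSubset U′ → U ≡ U′
encodeSubset-injective {q} eq = Pointwise-≡⇒≡ (ext (bit-injective ∘ encode-injective q eq))

module Arithmetic where
  open Nat using (_+_)

  n<2^n : ∀ n → n < 2 ^ n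
  n<2^n zero    = s≤s z≤n
  n<2^n (suc n) = begin-strict
    suc n           ≡⟨ +-comm 1 n ⟩
    n + 1           <⟨ +-mono-<-≤ (n<2^n n) (m^n>0 2 n) ⟩
    2 ^ n + 2 ^ n   ≡⟨ cong (2 ^ n +_) (+-identityʳ (2 ^ n)) ⟨
    2 ^ suc n       ∎
    where open ≤-Reasoning

  12*n≤2^n+64 : ∀ n → 12 * n ≤ 2 ^ n + 64
  12*n≤2^n+64 0 = z≤n
  12*n≤2^n+64 1 = m≤n⇒m≤o+n 2 (m≤n+m 12 52)
  12*n≤2^n+64 2 = m≤n⇒m≤o+n 4 (m≤n+m 24 40)
  12*n≤2^n+64 3 = m≤n⇒m≤o+n 8 (m≤n+m 36 28)
  12*n≤2^n+64 4 = m≤n⇒m≤o+n 16 (m≤n+m 48 16)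
  12*n≤2^n+64 (suc n@(suc (suc (suc (suc _))))) = begin
    12 * suc n             ≡⟨ *-suc 12 n ⟩
    12 + 12 * n            ≤⟨ +-mono-≤ 12≤2^n (12*n≤2^n+64 n) ⟩
    2 ^ n + (2 ^ n + 64)   ≡⟨ +-assoc (2 ^ n) (2 ^ n) 64 ⟨
    2 ^ n + 2 ^ n + 64     ≡⟨ cong (λ x → 2 ^ n + x + 64) (+-identityʳ (2 ^ n)) ⟨
    2 ^ suc n + 64         ∎
    where
    open ≤-Reasoning
    12≤2^n : 12 ≤ 2 ^ n
    12≤2^n = ≤-trans (m≤m+n 12 4) (^-monoʳ-≤ 2 {4} {n} (s≤s (s≤s (s≤s (s≤s z≤n)))))

  module _ {q h s : ℕ} (q≡h+s : q ≡ h + s) (h≤s : h ≤ s) where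

    3*n+m≤s : ∀ n m → 2 ^ n ≤ q → 64 + 4 * m ≤ q → 3 * n + m ≤ s
    3*n+m≤s n m 2^n≤q 64+4*m≤q = *-cancelˡ-≤ 4 (begin
      4 * (3 * n + m)        ≡⟨ *-distribˡ-+ 4 (3 * n) m ⟩
      4 * (3 * n) + 4 * m    ≡⟨ cong (_+ 4 * m) (*-assoc 4 3 n) ⟨
      12 * n + 4 * m         ≤⟨ +-monoˡ-≤ (4 * m) (12*n≤2^n+64 n) ⟩
      2 ^ n + 64 + 4 * m     ≡⟨ +-assoc (2 ^ n) 64 (4 * m) ⟩
      2 ^ n + (64 + 4 * m)   ≤⟨ +-mono-≤ 2^n≤q 64+4*m≤q ⟩
      q + q                  ≡⟨ cong₂ _+_ q≡h+s q≡h+s ⟩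
      (h + s) + (h + s)      ≤⟨ +-mono-≤ h+s≤s+s h+s≤s+s ⟩
      (s + s) + (s + s)      ≡⟨ s+s+[s+s]≡4*s s ⟩
      4 * s                  ∎)
      where
      open ≤-Reasoning
      h+s≤s+s : h + s ≤ s + s
      h+s≤s+s = +-monoˡ-≤ s h≤s
      s+s+[s+s]≡4*s : ∀ s → (s + s) + (s + s) ≡ 4 * s
      s+s+[s+s]≡4*s = solve-∀

    2^q*[q^n*q^h]*[1+m]≤q^q : ∀ n m → 3 * n + m ≤ s → 8 ≤ q → 2 ^ q * (q ^ n * q ^ h) * suc m ≤ q ^ q
    2^q*[q^n*q^h]*[1+m]≤q^q n m 3*n+m≤s 8≤q
      with m≤n⇒∃[o]m+o≡n (≤-trans (m≤m+n n (2 * n)) (≤-trans (m≤m+n (3 * n) m) 3*n+m≤s))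
    ... | t , refl = begin
      2 ^ q * (q ^ n * q ^ h) * suc m     ≡⟨ reorder (2 ^ q) (q ^ n) (q ^ h) (suc m) ⟩
      q ^ h * (q ^ n * (2 ^ q * suc m))   ≤⟨ *-monoʳ-≤ (q ^ h) (*-monoʳ-≤ (q ^ n) 2^q*[1+m]≤q^t) ⟩
      q ^ h * (q ^ n * q ^ t)             ≡⟨ cong (q ^ h *_) (^-distribˡ-+-* q n t) ⟨
      q ^ h * q ^ (n + t)                 ≡⟨ ^-distribˡ-+-* q h (n + t) ⟨
      q ^ (h + (n + t))                   ≡⟨ cong (q ^_) q≡h+s ⟨
      q ^ q                               ∎
      where
      open ≤-Reasoning
      reorder : ∀ a b c d → a * (b * c) * d ≡ c * (b * (a * d))
      reorder = solve-∀
      2*n+m≤t : 2 * n + m ≤ t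
      2*n+m≤t = +-cancelˡ-≤ n _ _ (subst (_≤ n + t) (+-assoc n (2 * n) m) 3*n+m≤s)
      q+m≤3*t : q + m ≤ 3 * t
      q+m≤3*t = begin
        q + m                       ≡⟨ cong (_+ m) q≡h+s ⟩
        h + (n + t) + m             ≤⟨ +-monoˡ-≤ m (+-monoˡ-≤ (n + t) h≤s) ⟩
        (n + t) + (n + t) + m       ≡⟨ regroup n t m ⟩
        (2 * n + m) + 2 * t         ≤⟨ +-monoˡ-≤ (2 * t) 2*n+m≤t ⟩
        3 * t                       ∎
        where
        regroup : ∀ n t m → (n + t) + (n + t) + m ≡ (2 * n + m) + 2 * t
        regroup = solve-∀
      2^q*[1+m]≤q^t : 2 ^ q * suc m ≤ q ^ t
      2^q*[1+m]≤q^t = begin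
        2 ^ q * suc m    ≤⟨ *-monoʳ-≤ (2 ^ q) (n<2^n m) ⟩
        2 ^ q * 2 ^ m    ≡⟨ ^-distribˡ-+-* 2 q m ⟨
        2 ^ (q + m)      ≤⟨ ^-monoʳ-≤ 2 q+m≤3*t ⟩
        2 ^ (3 * t)      ≡⟨ ^-*-assoc 2 3 t ⟨
        8 ^ t            ≤⟨ ^-monoˡ-≤ t 8≤q ⟩
        q ^ t            ∎

  m*n^k≡n^l⇒1<m : ∀ {m n k l} → 1 < n → k < l → m * n ^ k ≡ n ^ l → 1 < m
  m*n^k≡n^l⇒1<m {m} {n} {k} {l} 1<n k<l eq = ≰⇒> λ m≤1 → <⇒≱ (^-monoʳ-< n 1<n k<l) (begin
    n ^ l       ≡⟨ eq ⟨
    m * n ^ k   ≤⟨ *-monoˡ-≤ (n ^ k) m≤1 ⟩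
    1 * n ^ k   ≡⟨ *-identityˡ (n ^ k) ⟩
    n ^ k       ∎)
    where open ≤-Reasoning

open Arithmetic

module Cosets {q : ℕ} (F : FiniteField q) (U : Subset q) where
  open FiniteField F

  _∼_ : Fin q → Fin q → Set
  ξ ∼ η = (ξ + - η) ∈ U

  HasSmallerInCoset : Fin q → Set
  HasSmallerInCoset ξ = ∃[ η ] (η Fin.< ξ × ξ ∼ η)

  hasSmallerInCoset? : ∀ ξ → Dec (HasSmallerInCoset ξ)
  hasSmallerInCoset? ξ = Finₚ.any? (λ η → (η Finₚ.<? ξ) ×-dec ((ξ + - η) ∈? U))

  representatives : List (Fin q)
  representatives = List.filter (¬? ∘ hasSmallerInCoset?) (List.allFin q)

  representatives-unique : Unique representatives
  representatives-unique = Uniqueₚ.filter⁺ (¬? ∘ hasSmallerInCoset?) (Uniqueₚ.allFin⁺ q)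

  encodeOnRepresentatives : Vec (Fin q) q → Fin (q ^ length representatives)
  encodeOnRepresentatives v = encode (length representatives) (lookup v ∘ List.lookup representatives)

  encodeOnRepresentatives-injective : ∀ {v v′} → encodeOnRepresentatives v ≡ encodeOnRepresentatives v′ →
                                      ∀ {r} → r ∈ₗ representatives → lookup v r ≡ lookup v′ r
  encodeOnRepresentatives-injective {v} {v′} eq r∈ =
    subst (λ r → lookup v r ≡ lookup v′ r) (sym (lookup-index r∈))
      (encode-injective (length representatives) eq (index r∈))

  module _ (U-subgroup : IsFpSubspace F U) where
    open IsFpSubspace U-subgroup

    +-abelianGroup : AbelianGroup _ _
    +-abelianGroup = record
      { Carrier = Fin q ; _≈_ = _≡_ ; _∙_ = _+_ ; ε = 0# ; _⁻¹ = -_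
      ; isAbelianGroup = IsCommutativeRing.+-isAbelianGroup isCommutativeRing
      }
    open AbelianGroup +-abelianGroup using (assoc; inverseʳ; identityʳ)
    open AbelianGroupProperties +-abelianGroup using (⁻¹-anti-homo‿-; xyx⁻¹≈y; \\-leftDividesʳ; ∙-cancelˡ; ∙-cancelʳ)

    ∼-refl : ∀ ξ → ξ ∼ ξ
    ∼-refl ξ = subst (_∈ U) (sym (inverseʳ ξ)) zero∈

    ∼-sym : ∀ {ξ η} → ξ ∼ η → η ∼ ξ
    ∼-sym {ξ} {η} = subst (_∈ U) (⁻¹-anti-homo‿- ξ η) ∘ neg-closed

    ∼-trans : ∀ {ξ η ζ} → ξ ∼ η → η ∼ ζ → ξ ∼ ζ
    ∼-trans {ξ} {η} {ζ} ξ∼η η∼ζ = subst (_∈ U) telescope (+-closed ξ∼η η∼ζ)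
      where
      telescope : (ξ + - η) + (η + - ζ) ≡ ξ + - ζ
      telescope = trans (assoc ξ (- η) (η + - ζ)) (cong (ξ +_) (\\-leftDividesʳ η (- ζ)))

    +-∼ : ∀ ξ {u} → u ∈ U → (ξ + u) ∼ ξ
    +-∼ ξ {u} = subst (_∈ U) (sym (xyx⁻¹≈y ξ u))

    ∼-representative : ∀ ξ → ∃[ r ] (r ∈ₗ representatives × ξ ∼ r)
    ∼-representative ξ = descend ξ (<-wellFounded ξ)
      where
      descend : ∀ ξ → Acc Fin._<_ ξ → ∃[ r ] (r ∈ₗ representatives × ξ ∼ r)
      descend ξ (acc smaller) with hasSmallerInCoset? ξ
      ... | no ξ-least = ξ , ∈-filter⁺ (¬? ∘ hasSmallerInCoset?) (∈-allFin ξ) ξ-least , ∼-refl ξ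
      ... | yes (η , η<ξ , ξ∼η) =
        let r , r∈ , η∼r = descend η (smaller η<ξ) in r , r∈ , ∼-trans ξ∼η η∼r

    2*∣representatives∣≤q : ∀ {u} → u ∈ U → u ≢ 0# →
                             length representatives Nat.+ length representatives ≤ q
    2*∣representatives∣≤q {u} u∈U u≢0 = begin
      length R Nat.+ length R                    ≡⟨ cong (length R Nat.+_) (length-map (_+ u) R) ⟨
      length R Nat.+ length (List.map (_+ u) R)  ≡⟨ length-++ R ⟨
      length (R List.++ List.map (_+ u) R)       ≤⟨ Unique⇒length≤ unique ⟩
      q                                          ∎
      where
      open ≤-Reasoning
      R = representatives
      least : ∀ {r} → r ∈ₗ R → ¬ HasSmallerInCoset r
      least = proj₂ ∘ ∈-filter⁻ (¬? ∘ hasSmallerInCoset?) {xs = List.allFin q}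
      disjoint : ∀ {v} → ¬ (v ∈ₗ R × v ∈ₗ List.map (_+ u) R)
      disjoint (r+u∈ , r+u∈′) with ∈-map⁻ (_+ u) r+u∈′
      ... | r , r∈ , refl with Finₚ.<-cmp r (r + u)
      ... | tri< r<r+u _ _ = least r+u∈ (r , r<r+u , +-∼ r u∈U)
      ... | tri> _ _ r+u<r = least r∈ (r + u , r+u<r , ∼-sym (+-∼ r u∈U))
      ... | tri≈ _ r≡r+u _ = u≢0 (∙-cancelˡ r u 0# (trans (sym r≡r+u) (sym (identityʳ r))))
      unique : Unique (R List.++ List.map (_+ u) R)
      unique = Uniqueₚ.++⁺ representatives-unique
                 (Uniqueₚ.map⁺ (∙-cancelʳ u _ _) representatives-unique) disjoint

    agree-on-representatives⇒≗ : ∀ {f f′ M M′ a a′ : Fin q → Fin q} →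
      (∀ ξ η → ξ ∼ η → a ξ ≡ a η) → (∀ ξ η → ξ ∼ η → a′ ξ ≡ a′ η) →
      (∀ ξ → f ξ ≡ M ξ + a ξ) → (∀ ξ → f′ ξ ≡ M′ ξ + a′ ξ) → (∀ ξ → M ξ ≡ M′ ξ) →
      (∀ {r} → r ∈ₗ representatives → f r ≡ f′ r) → ∀ ξ → f ξ ≡ f′ ξ
    agree-on-representatives⇒≗ {f} {f′} {M} {M′} {a} {a′} a-const a′-const f≡ f′≡ M≗M′ agree ξ
      with ∼-representative ξ
    ... | r , r∈ , ξ∼r = begin
      f ξ           ≡⟨ f≡ ξ ⟩
      M ξ + a ξ     ≡⟨ cong₂ _+_ (M≗M′ ξ) (trans (a-const ξ r ξ∼r) (trans a[r]≡a′[r] (sym (a′-const ξ r ξ∼r)))) ⟩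
      M′ ξ + a′ ξ   ≡⟨ f′≡ ξ ⟨
      f′ ξ          ∎
      where
      open ≡-Reasoning
      a[r]≡a′[r] : a r ≡ a′ r
      a[r]≡a′[r] = ∙-cancelˡ (M r) (a r) (a′ r) (begin
        M r + a r     ≡⟨ f≡ r ⟨
        f r           ≡⟨ agree r∈ ⟩
        f′ r          ≡⟨ f′≡ r ⟩
        M′ r + a′ r   ≡⟨ cong (_+ a′ r) (M≗M′ r) ⟨
        M r + a′ r    ∎)

sumF-cong : ∀ {q} (F : FiniteField q) m {f g : Fin m → Fin q} →
            (∀ j → f j ≡ g j) → sumF F m f ≡ sumF F m g
sumF-cong F zero    _   = refl
sumF-cong F (suc m) f≗g = cong₂ (FiniteField._+_ F) (f≗g Fin.zero) (sumF-cong F m (f≗g ∘ Fin.suc))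

linearised-cong : ∀ {q} (F : FiniteField q) p n {c c′ : Fin n → Fin q} →
                  (∀ j → c j ≡ c′ j) → ∀ ξ → linearised F p n c ξ ≡ linearised F p n c′ ξ
linearised-cong F p n c≗c′ ξ =
  sumF-cong F n (λ j → cong (λ z → FiniteField._*_ F z (pow F ξ (p ^ toℕ j))) (c≗c′ j))

module SmallCodimension {p n : ℕ} (1<p : 1 < p) (F : FiniteField (p ^ n)) where
  open FiniteField F using (0#)

  q h : ℕ
  q = p ^ n
  h = ⌊ q /2⌋

  instance
    p≢0 : NonZero p
    p≢0 = Nat.>-nonZero (<-trans (s≤s z≤n) 1<p)
    q≢0 : NonZero q
    q≢0 = m^n≢0 p n

  #codes : ℕ
  #codes = 2 ^ q * (q ^ n * q ^ h)

  HasSmallCodim : Vec (Fin q) q → Set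
  HasSmallCodim v = ∃[ k ] (HasCodim F p n (lookup v) k × k < n)

  ∣representatives∣≤⌊q/2⌋ : ∀ {U k} → IsFpSubspace F U → ∣ U ∣ * p ^ k ≡ q → k < n →
                            length (Cosets.representatives F U) ≤ h
  ∣representatives∣≤⌊q/2⌋ {U} U-subgroup ∣U∣*p^k≡q k<n =
    let u , u∈U , u≢0 = 1<∣U∣⇒∃∈≢ (m*n^k≡n^l⇒1<m 1<p k<n ∣U∣*p^k≡q) 0# in
    subst (_≤ h) (sym (n≡⌊n+n/2⌋ _)) (⌊n/2⌋-mono (2*∣representatives∣≤q U-subgroup u∈U u≢0))
    where open Cosets F U

  subspace : ∀ {v} → HasSmallCodim v → Subset q
  subspace (_ , (U , _) , _) = U

  linearPartAndValues : (v : Vec (Fin q) q) → HasSmallCodim v → Fin (q ^ n * q ^ h)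
  linearPartAndValues v (k , (U , U-subgroup , ∣U∣*p^k≡q , c , _) , k<n) =
    combine (encode n c) (inject≤ (encodeOnRepresentatives v)
                                  (^-monoʳ-≤ q (∣representatives∣≤⌊q/2⌋ U-subgroup ∣U∣*p^k≡q k<n)))
    where open Cosets F U

  linearPartAndValues-injective : ∀ {v v′} pf pf′ → subspace {v} pf ≡ subspace {v′} pf′ →
    linearPartAndValues v pf ≡ linearPartAndValues v′ pf′ → v ≡ v′
  linearPartAndValues-injective {v} {v′} (_ , (U , U-subgroup , _ , c , a , a-const , v≡) , _)
                                         (_ , (_ , _ , _ , c′ , a′ , a′-const , v′≡) , _) refl eq =
    let c≡c′ , values≡ = Finₚ.combine-injective (encode n c) _ (encode n c′) _ eq in
    Pointwise-≡⇒≡ (ext (agree-on-representatives⇒≗ U-subgroup a-const a′-const v≡ v′≡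
      (linearised-cong F p n (encode-injective n c≡c′))
      (encodeOnRepresentatives-injective {v} {v′} (Finₚ.inject≤-injective _ _ _ _ values≡))))
    where open Cosets F U

  code : (v : Vec (Fin q) q) → HasSmallCodim v → Fin #codes
  code v pf = combine (encodeSubset (subspace {v} pf)) (linearPartAndValues v pf)

  code-injective : ∀ {v v′} pf pf′ → code v pf ≡ code v′ pf′ → v ≡ v′
  code-injective {v} {v′} pf pf′ eq =
    let U≡U′ , rest = Finₚ.combine-injective _ _ _ _ eq in
    linearPartAndValues-injective pf pf′
      (encodeSubset-injective {U = subspace {v} pf} {subspace {v′} pf′} U≡U′) rest

  fromLeastCodim : ∀ {v} → ∃[ k ] (LeastCodim F p n (lookup v) k × k < n) → HasSmallCodim v
  fromLeastCodim (k , (codim , _) , k<n) = k , codim , k<n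

  length≤#codes : ∀ {L} → Unique L → All HasSmallCodim L → length L ≤ #codes
  length≤#codes = length≤-of-injective-code code code-injective

  #codes*[1+m]≤q^q : ∀ {m} → 64 Nat.+ 4 * m ≤ q → #codes * suc m ≤ q ^ q
  #codes*[1+m]≤q^q {m} 64+4*m≤q =
    2^q*[q^n*q^h]*[1+m]≤q^q q≡h+s h≤s n m (3*n+m≤s q≡h+s h≤s n m 2^n≤q 64+4*m≤q) 8≤q
    where
    q≡h+s : q ≡ h Nat.+ ⌈ q /2⌉
    q≡h+s = sym (⌊n/2⌋+⌈n/2⌉≡n q)
    h≤s : h ≤ ⌈ q /2⌉
    h≤s = ⌊n/2⌋≤⌈n/2⌉ q
    2^n≤q : 2 ^ n ≤ q
    2^n≤q = ^-monoˡ-≤ n 1<p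
    8≤q : 8 ≤ q
    8≤q = ≤-trans (m≤m+n 8 (56 Nat.+ 4 * m)) 64+4*m≤q

corollary4p14 : ∀ (m : ℕ) → ∃[ N ] (∀ (p n : ℕ) → Prime p → N ≤ p ^ n →
    (F : FiniteField (p ^ n)) →
    (L : List (Vec (Fin (p ^ n)) (p ^ n))) → Unique L →
    All (λ v → ∃[ k ] (LeastCodim F p n (lookup v) k × k < n)) L →
    length L * suc m ≤ (p ^ n) ^ (p ^ n))
corollary4p14 m = 64 + 4 * m , λ p n p-prime 64+4*m≤q F L L-unique L-small →
  let open SmallCodimension {n = n} (nonTrivial⇒n>1 p {{prime⇒nonTrivial p-prime}}) F in
  ≤-trans (*-monoˡ-≤ (suc m) (length≤#codes L-unique (All.map (λ {v} → fromLeastCodim {v}) L-small)))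
          (#codes*[1+m]≤q^q 64+4*m≤q)
  where open Nat using (_+_)
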